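{- Let $e \geq 2$ be an even integer and let $R = \mathbb{Z}_2[\sqrt[e]{2}]$. Then every element of $R^2$ can be written as a sum of at most $3$ squares of elements of $R$.
   Context: For a ring $R$, $R^2$ denotes the additive semigroup generated by all squares of elements of $R$. $\mathbb{Z}_2[\sqrt[e]{2}]$ is the ring of integers of $\mathbb{Q}_2(\sqrt[e]{2})$. -}

module Defs where

open import Data.Nat using (ℕ; zero; suc; _+_; _*_; _^_; _%_; _≡ᵇ_; ⌊_/2⌋)
open import Data.Bool using (Bool; true; false; if_then_else_)
open import Data.Fin using (Fin; toℕ)
import Data.Fin as F
open import Data.List using (List; []; _∷_)
open import Relation.Binary.PropositionalEquality using (_≡_)

-- The 2-adic integers ℤ₂, modelled as streams of binary digits:
-- x represents Σ_k (x k) 2^k.  Every stream is a 2-adic integer and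
-- conversely, so this is a faithful concrete model of ℤ₂.

ℤ₂ : Set
ℤ₂ = ℕ → Bool

approx : ℤ₂ → ℕ → ℕ
approx x zero    = 0
approx x (suc n) = approx x n + (if x n then 2 ^ n else 0)

bitAt : ℕ → ℕ → Bool
bitAt m zero    = (m % 2) ≡ᵇ 1
bitAt m (suc k) = bitAt ⌊ m /2⌋ k

-- build a 2-adic integer from a compatible family of values g n
-- (g n only matters modulo 2^n): digit k is digit k of g (k+1).
lift : (ℕ → ℕ) → ℤ₂
lift g k = bitAt (g (suc k)) k

0ℤ₂ : ℤ₂
0ℤ₂ _ = false

infixl 6 _+ℤ₂_
infixl 7 _*ℤ₂_

_+ℤ₂_ : ℤ₂ → ℤ₂ → ℤ₂
x +ℤ₂ y = lift (λ n → approx x n + approx y n)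

_*ℤ₂_ : ℤ₂ → ℤ₂ → ℤ₂
x *ℤ₂ y = lift (λ n → approx x n * approx y n)

_≈ℤ₂_ : ℤ₂ → ℤ₂ → Set
x ≈ℤ₂ y = ∀ n → x n ≡ y n

sumFin : ∀ {n} → (Fin n → ℤ₂) → ℤ₂
sumFin {zero}  f = 0ℤ₂
sumFin {suc n} f = f F.zero +ℤ₂ sumFin (λ i → f (F.suc i))

-- R = ℤ₂[ 2^{1/e} ] ≅ ℤ₂[t]/(t^e − 2)  (t^e − 2 is Eisenstein, so this
-- is the ring of integers of ℚ₂(2^{1/e})).  An element is its vector of
-- coordinates in the ℤ₂-basis 1, t, …, t^{e-1}.

R : ℕ → Set
R e = Fin e → ℤ₂

0R : ∀ e → R e
0R e _ = 0ℤ₂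

_+R_ : ∀ {e} → R e → R e → R e
(x +R y) i = x i +ℤ₂ y i

-- product with reduction t^e = 2:
-- coefficient k = Σ_{i+j=k} x_i y_j + 2 Σ_{i+j=k+e} x_i y_j
_*R_ : ∀ {e} → R e → R e → R e
_*R_ {e} x y k = sumFin (λ i → sumFin (λ j → term i j))
  where
  term : Fin e → Fin e → ℤ₂
  term i j =
    if (toℕ i + toℕ j) ≡ᵇ toℕ k then x i *ℤ₂ y j
    else if (toℕ i + toℕ j) ≡ᵇ (toℕ k + e) then (x i *ℤ₂ y j) +ℤ₂ (x i *ℤ₂ y j)
    else 0ℤ₂

_≈R_ : ∀ {e} → R e → R e → Set
x ≈R y = ∀ i → x i ≈ℤ₂ y i

-- R² : the additive semigroup generated by the squares of R
data InR² (e : ℕ) : R e → Set where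
  square : ∀ {y} (x : R e) → y ≈R (x *R x) → InR² e y
  plus   : ∀ {y} (a b : R e) → InR² e a → InR² e b → y ≈R (a +R b) → InR² e y

sumSq : ∀ e → List (R e) → R e
sumSq e []       = 0R e
sumSq e (x ∷ xs) = (x *R x) +R sumSq e xs

{-# OPTIONS --safe #-}
module Submission where

-- An element of R² is a sum of squares Σ xᵢ², and Σ xᵢ² = s² − 2u for s = Σ xᵢ and
-- u = Σ_{i<j} xᵢxⱼ, so it suffices to write every s² − 2u as a sum of three squares.
-- In R = ℤ₂[t]/(tᵉ − 2) the element ρ = t^(e/2) satisfies ρ² = 2, and Hensel's lemma
-- gives c ∈ ℤ₂ with 19c² + 5 = 0 (as 19 + 5 ≡ 0 mod 8).  Then α = 1 − 6cρ, β = 2c + 3ρ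
-- and γ = 36c² − 6cρ satisfy 1 + α² + β² = 0 and 2 + β² + 2γ = 0, and for d = s − 1,
-- w = 1 − βd and l = s² − s − u + βd + γd² one checks
--   (w + l)² + (lα)² + (d + lβ)² = s² − 2u.

open import Algebra.Bundles using (CommutativeMonoid; CommutativeRing)
open import Data.Nat using (ℕ)
open import Defs

-- fromℕ uses the TCOptimised _×_, so that the solver constants con (+ 1) and
-- con (+ 2) are definitionally 1# and 1# + 1#.
module IntegerCoefficients {c ℓ} (R : CommutativeRing c ℓ) where

  open import Data.Integer as ℤ using (ℤ; +_; -[1+_]; _⊖_)
  import Data.Integer.Properties as ℤ
  open import Data.Maybe using (Maybe; just; nothing)
  open import Data.Nat as ℕ using (zero; suc)
  import Data.Nat.Properties as ℕ
  open import Data.Sign as Sign using (Sign)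
  open import Relation.Nullary using (yes; no)
  open import Relation.Binary.PropositionalEquality as ≡ using (_≡_)
  import Algebra.Solver.Ring.AlmostCommutativeRing as ACR

  open CommutativeRing R
  open import Algebra.Properties.Ring ring
    using (-0#≈0#; -‿involutive; -‿distribˡ-*; -‿distribʳ-*; -‿+-comm)
  open import Algebra.Properties.Semiring.Mult.TCOptimised semiring using (_×_; 1+×; ×-homo-+; ×1-homo-*)
  open import Relation.Binary.Reasoning.Setoid setoid

  fromℕ : ℕ → Carrier
  fromℕ n = n × 1#

  fromℤ : ℤ → Carrier
  fromℤ (+ n)    = fromℕ n
  fromℤ -[1+ n ] = - fromℕ (suc n)

  private
    1+x-[1+y]≈x-y : ∀ x y → (1# + x) - (1# + y) ≈ x - y
    1+x-[1+y]≈x-y x y = begin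
      (1# + x) - (1# + y)     ≈⟨ +-congˡ (-‿+-comm 1# y) ⟨
      (1# + x) + (- 1# - y)   ≈⟨ +-congʳ (+-comm 1# x) ⟩
      (x + 1#) + (- 1# - y)   ≈⟨ +-assoc x 1# _ ⟩
      x + (1# + (- 1# - y))   ≈⟨ +-congˡ (+-assoc 1# (- 1#) (- y)) ⟨
      x + ((1# - 1#) - y)     ≈⟨ +-congˡ (+-congʳ (-‿inverseʳ 1#)) ⟩
      x + (0# - y)            ≈⟨ +-congˡ (+-identityˡ (- y)) ⟩
      x - y                   ∎

  fromℤ-⊖ : ∀ m n → fromℤ (m ⊖ n) ≈ fromℕ m - fromℕ n
  fromℤ-⊖ zero    zero    = sym (-‿inverseʳ 0#)
  fromℤ-⊖ (suc m) zero    = sym (trans (+-congˡ -0#≈0#) (+-identityʳ _))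
  fromℤ-⊖ zero    (suc n) = sym (+-identityˡ _)
  fromℤ-⊖ (suc m) (suc n) = begin
    fromℤ (suc m ⊖ suc n)            ≡⟨ ≡.cong fromℤ (ℤ.[1+m]⊖[1+n]≡m⊖n m n) ⟩
    fromℤ (m ⊖ n)                    ≈⟨ fromℤ-⊖ m n ⟩
    fromℕ m - fromℕ n                ≈⟨ 1+x-[1+y]≈x-y (fromℕ m) (fromℕ n) ⟨
    (1# + fromℕ m) - (1# + fromℕ n)  ≈⟨ +-cong (1+× m 1#) (-‿cong (1+× n 1#)) ⟨
    fromℕ (suc m) - fromℕ (suc n)    ∎

  fromℤ-+ : ∀ i j → fromℤ (i ℤ.+ j) ≈ fromℤ i + fromℤ j
  fromℤ-+ (+ m)    (+ n)    = ×-homo-+ 1# m n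
  fromℤ-+ (+ m)    -[1+ n ] = fromℤ-⊖ m (suc n)
  fromℤ-+ -[1+ m ] (+ n)    = trans (fromℤ-⊖ n (suc m)) (+-comm _ _)
  fromℤ-+ -[1+ m ] -[1+ n ] = begin
    - fromℕ (suc (suc (m ℕ.+ n)))      ≡⟨ ≡.cong (λ k → - fromℕ (suc k)) (ℕ.+-suc m n) ⟨
    - fromℕ (suc m ℕ.+ suc n)          ≈⟨ -‿cong (×-homo-+ 1# (suc m) (suc n)) ⟩
    - (fromℕ (suc m) + fromℕ (suc n))  ≈⟨ -‿+-comm _ _ ⟨
    - fromℕ (suc m) - fromℕ (suc n)    ∎

  private
    fromℤ-◃⁺ : ∀ n → fromℤ (Sign.+ ℤ.◃ n) ≈ fromℕ n
    fromℤ-◃⁺ zero    = refl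
    fromℤ-◃⁺ (suc n) = refl

    fromℤ-◃⁻ : ∀ n → fromℤ (Sign.- ℤ.◃ n) ≈ - fromℕ n
    fromℤ-◃⁻ zero    = sym -0#≈0#
    fromℤ-◃⁻ (suc n) = refl

  fromℤ-* : ∀ i j → fromℤ (i ℤ.* j) ≈ fromℤ i * fromℤ j
  fromℤ-* (+ m)    (+ n)    = trans (fromℤ-◃⁺ (m ℕ.* n)) (×1-homo-* m n)
  fromℤ-* (+ m)    -[1+ n ] = begin
    fromℤ (Sign.- ℤ.◃ m ℕ.* suc n)  ≈⟨ fromℤ-◃⁻ (m ℕ.* suc n) ⟩
    - fromℕ (m ℕ.* suc n)           ≈⟨ -‿cong (×1-homo-* m (suc n)) ⟩
    - (fromℕ m * fromℕ (suc n))     ≈⟨ -‿distribʳ-* _ _ ⟩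
    fromℕ m * - fromℕ (suc n)       ∎
  fromℤ-* -[1+ m ] (+ n)    = begin
    fromℤ (Sign.- ℤ.◃ suc m ℕ.* n)  ≈⟨ fromℤ-◃⁻ (suc m ℕ.* n) ⟩
    - fromℕ (suc m ℕ.* n)           ≈⟨ -‿cong (×1-homo-* (suc m) n) ⟩
    - (fromℕ (suc m) * fromℕ n)     ≈⟨ -‿distribˡ-* _ _ ⟩
    - fromℕ (suc m) * fromℕ n       ∎
  fromℤ-* -[1+ m ] -[1+ n ] = begin
    fromℤ (Sign.+ ℤ.◃ suc m ℕ.* suc n)  ≈⟨ fromℤ-◃⁺ (suc m ℕ.* suc n) ⟩
    fromℕ (suc m ℕ.* suc n)             ≈⟨ ×1-homo-* (suc m) (suc n) ⟩
    fromℕ (suc m) * fromℕ (suc n)       ≈⟨ -‿involutive _ ⟨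
    - - (fromℕ (suc m) * fromℕ (suc n)) ≈⟨ -‿cong (-‿distribˡ-* _ _) ⟩
    - (- fromℕ (suc m) * fromℕ (suc n)) ≈⟨ -‿distribʳ-* _ _ ⟩
    - fromℕ (suc m) * - fromℕ (suc n)   ∎

  fromℤ-neg : ∀ i → fromℤ (ℤ.- i) ≈ - fromℤ i
  fromℤ-neg (+ zero)  = sym -0#≈0#
  fromℤ-neg (+ suc n) = refl
  fromℤ-neg -[1+ n ]  = sym (-‿involutive _)

  fromℤ-morphism : ℤ.+-*-rawRing ACR.-Raw-AlmostCommutative⟶ ACR.fromCommutativeRing R
  fromℤ-morphism = record
    { ⟦_⟧    = fromℤ
    ; +-homo = fromℤ-+
    ; *-homo = fromℤ-*
    ; -‿homo = fromℤ-neg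
    ; 0-homo = refl
    ; 1-homo = refl
    }

  private
    fromℤ-≟ : ∀ i j → Maybe (fromℤ i ≈ fromℤ j)
    fromℤ-≟ i j with i ℤ.≟ j
    ... | yes ≡.refl = just refl
    ... | no _       = nothing

  open import Algebra.Solver.Ring ℤ.+-*-rawRing (ACR.fromCommutativeRing R) fromℤ-morphism fromℤ-≟ public

module SumsOfSquares {c ℓ} (R : CommutativeRing c ℓ) where

  open import Data.Integer using (+_)
  open import Data.List using (List; []; _∷_; _++_; length)
  open import Data.Product using (Σ-syntax; _×_; _,_)
  open import Relation.Binary.PropositionalEquality as ≡ using (_≡_)

  open CommutativeRing R
  private module Coefficients = IntegerCoefficients R
  open Coefficients
  open Coefficients public using (fromℕ)
  open import Relation.Binary.Reasoning.Setoid setoid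

  sumOfSquares : List Carrier → Carrier
  sumOfSquares []       = 0#
  sumOfSquares (x ∷ xs) = x * x + sumOfSquares xs

  sumOfSquares-++ : ∀ xs ys → sumOfSquares (xs ++ ys) ≈ sumOfSquares xs + sumOfSquares ys
  sumOfSquares-++ []       ys = sym (+-identityˡ _)
  sumOfSquares-++ (x ∷ xs) ys = trans (+-congˡ (sumOfSquares-++ xs ys)) (sym (+-assoc _ _ _))

  σ₁ σ₂ : List Carrier → Carrier
  σ₁ []       = 0#
  σ₁ (x ∷ xs) = x + σ₁ xs
  σ₂ []       = 0#
  σ₂ (x ∷ xs) = x * σ₁ xs + σ₂ xs

  sumOfSquares≈σ₁²-2σ₂ : ∀ xs → sumOfSquares xs ≈ σ₁ xs * σ₁ xs - (σ₂ xs + σ₂ xs)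
  sumOfSquares≈σ₁²-2σ₂ []       = solve 0 (con (+ 0) := con (+ 0) :* con (+ 0) :- (con (+ 0) :+ con (+ 0))) refl
  sumOfSquares≈σ₁²-2σ₂ (x ∷ xs) = begin
    x * x + sumOfSquares xs                          ≈⟨ +-congˡ (sumOfSquares≈σ₁²-2σ₂ xs) ⟩
    x * x + (s * s - (p + p))                        ≈⟨ newton x s p ⟩
    (x + s) * (x + s) - ((x * s + p) + (x * s + p))  ∎
    where
    s = σ₁ xs
    p = σ₂ xs
    newton : ∀ x s p → x * x + (s * s - (p + p)) ≈ (x + s) * (x + s) - ((x * s + p) + (x * s + p))
    newton = solve 3 (λ x s p → x :* x :+ (s :* s :- (p :+ p)) := (x :+ s) :* (x :+ s) :- ((x :* s :+ p) :+ (x :* s :+ p))) refl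

  module _ {α β γ : Carrier}
           (1+α²+β²≈0 : 1# + α * α + β * β ≈ 0#)
           (2+β²+2γ≈0 : fromℕ 2 + β * β + fromℕ 2 * γ ≈ 0#) where

    private
      w : Carrier → Carrier
      w d = 1# - β * d

      -- The cross terms give 2l(w d + βd) = 2l, and the l²-terms cancel by 1 + α² + β² = 0.
      sumOfSquares-ansatz : ∀ d l → sumOfSquares (w d + l ∷ l * α ∷ d + l * β ∷ []) ≈ w d * w d + d * d + fromℕ 2 * l
      sumOfSquares-ansatz d l = begin
        sumOfSquares (w d + l ∷ l * α ∷ d + l * β ∷ [])                  ≈⟨ expand d l α β ⟩
        w d * w d + d * d + fromℕ 2 * l + l * l * (1# + α * α + β * β)   ≈⟨ +-congˡ (trans (*-congˡ 1+α²+β²≈0) (zeroʳ _)) ⟩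
        w d * w d + d * d + fromℕ 2 * l + 0#                             ≈⟨ +-identityʳ _ ⟩
        w d * w d + d * d + fromℕ 2 * l                                  ∎
        where
        expand : ∀ d l α β →
          (1# - β * d + l) * (1# - β * d + l) + ((l * α) * (l * α) + ((d + l * β) * (d + l * β) + 0#))
          ≈ (1# - β * d) * (1# - β * d) + d * d + fromℕ 2 * l + l * l * (1# + α * α + β * β)
        expand = solve 4 (λ d l α β →
          (con (+ 1) :- β :* d :+ l) :* (con (+ 1) :- β :* d :+ l) :+ ((l :* α) :* (l :* α) :+ ((d :+ l :* β) :* (d :+ l :* β) :+ con (+ 0)))
          := (con (+ 1) :- β :* d) :* (con (+ 1) :- β :* d) :+ d :* d :+ con (+ 2) :* l :+ l :* l :* (con (+ 1) :+ α :* α :+ β :* β)) refl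

      d : Carrier → Carrier
      d s = s - 1#

      l : Carrier → Carrier → Carrier
      l s u = s * s - s - u + β * d s + γ * d s * d s

    threeSquares : Carrier → Carrier → List Carrier
    threeSquares s u = w (d s) + l s u ∷ l s u * α ∷ d s + l s u * β ∷ []

    sumOfSquares-threeSquares : ∀ s u → sumOfSquares (threeSquares s u) ≈ s * s - (u + u)
    sumOfSquares-threeSquares s u = begin
      sumOfSquares (threeSquares s u)                                   ≈⟨ sumOfSquares-ansatz (d s) (l s u) ⟩
      w (d s) * w (d s) + d s * d s + fromℕ 2 * l s u                   ≈⟨ expand s u β γ ⟩
      s * s - (u + u) + d s * d s * (fromℕ 2 + β * β + fromℕ 2 * γ)    ≈⟨ +-congˡ (trans (*-congˡ 2+β²+2γ≈0) (zeroʳ _)) ⟩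
      s * s - (u + u) + 0#                                              ≈⟨ +-identityʳ _ ⟩
      s * s - (u + u)                                                   ∎
      where
      expand : ∀ s u β γ →
        (1# - β * (s - 1#)) * (1# - β * (s - 1#)) + (s - 1#) * (s - 1#)
          + fromℕ 2 * (s * s - s - u + β * (s - 1#) + γ * (s - 1#) * (s - 1#))
        ≈ s * s - (u + u) + (s - 1#) * (s - 1#) * (fromℕ 2 + β * β + fromℕ 2 * γ)
      expand = solve 4 (λ s u β γ →
        (con (+ 1) :- β :* (s :- con (+ 1))) :* (con (+ 1) :- β :* (s :- con (+ 1))) :+ (s :- con (+ 1)) :* (s :- con (+ 1))
          :+ con (+ 2) :* (s :* s :- s :- u :+ β :* (s :- con (+ 1)) :+ γ :* (s :- con (+ 1)) :* (s :- con (+ 1)))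
        := s :* s :- (u :+ u) :+ (s :- con (+ 1)) :* (s :- con (+ 1)) :* (con (+ 2) :+ β :* β :+ con (+ 2) :* γ)) refl

  module _ {ρ c : Carrier}
           (ρ²≈2 : ρ * ρ ≈ fromℕ 2)
           (19c²+5≈0 : fromℕ 19 * (c * c) + fromℕ 5 ≈ 0#) where

    private
      α β γ : Carrier
      α = 1# - fromℕ 6 * c * ρ
      β = fromℕ 2 * c + fromℕ 3 * ρ
      γ = fromℕ 36 * c * c - fromℕ 6 * c * ρ

      ρ²-2≈0 : ρ * ρ - fromℕ 2 ≈ 0#
      ρ²-2≈0 = trans (+-congʳ ρ²≈2) (-‿inverseʳ _)

      vanishes : ∀ k → fromℕ 4 * (fromℕ 19 * (c * c) + fromℕ 5) + k * (ρ * ρ - fromℕ 2) ≈ 0#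
      vanishes k = begin
        fromℕ 4 * (fromℕ 19 * (c * c) + fromℕ 5) + k * (ρ * ρ - fromℕ 2) ≈⟨ +-cong (*-congˡ 19c²+5≈0) (*-congˡ ρ²-2≈0) ⟩
        fromℕ 4 * 0# + k * 0#                                             ≈⟨ +-cong (zeroʳ _) (zeroʳ _) ⟩
        0# + 0#                                                           ≈⟨ +-identityʳ 0# ⟩
        0#                                                                ∎

      1+α²+β²≈0 : 1# + α * α + β * β ≈ 0#
      1+α²+β²≈0 = trans (expand c ρ) (vanishes (fromℕ 36 * c * c + fromℕ 9))
        where
        expand : ∀ c ρ →
          1# + (1# - fromℕ 6 * c * ρ) * (1# - fromℕ 6 * c * ρ) + (fromℕ 2 * c + fromℕ 3 * ρ) * (fromℕ 2 * c + fromℕ 3 * ρ)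
          ≈ fromℕ 4 * (fromℕ 19 * (c * c) + fromℕ 5) + (fromℕ 36 * c * c + fromℕ 9) * (ρ * ρ - fromℕ 2)
        expand = solve 2 (λ c ρ →
          con (+ 1) :+ (con (+ 1) :- con (+ 6) :* c :* ρ) :* (con (+ 1) :- con (+ 6) :* c :* ρ) :+ (con (+ 2) :* c :+ con (+ 3) :* ρ) :* (con (+ 2) :* c :+ con (+ 3) :* ρ)
          := con (+ 4) :* (con (+ 19) :* (c :* c) :+ con (+ 5)) :+ (con (+ 36) :* c :* c :+ con (+ 9)) :* (ρ :* ρ :- con (+ 2))) refl

      2+β²+2γ≈0 : fromℕ 2 + β * β + fromℕ 2 * γ ≈ 0#
      2+β²+2γ≈0 = trans (expand c ρ) (vanishes (fromℕ 9))
        where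
        expand : ∀ c ρ →
          fromℕ 2 + (fromℕ 2 * c + fromℕ 3 * ρ) * (fromℕ 2 * c + fromℕ 3 * ρ) + fromℕ 2 * (fromℕ 36 * c * c - fromℕ 6 * c * ρ)
          ≈ fromℕ 4 * (fromℕ 19 * (c * c) + fromℕ 5) + fromℕ 9 * (ρ * ρ - fromℕ 2)
        expand = solve 2 (λ c ρ →
          con (+ 2) :+ (con (+ 2) :* c :+ con (+ 3) :* ρ) :* (con (+ 2) :* c :+ con (+ 3) :* ρ) :+ con (+ 2) :* (con (+ 36) :* c :* c :- con (+ 6) :* c :* ρ)
          := con (+ 4) :* (con (+ 19) :* (c :* c) :+ con (+ 5)) :+ con (+ 9) :* (ρ :* ρ :- con (+ 2))) refl

    sumOfSquares≈sumOfThreeSquares : ∀ xs → Σ[ ys ∈ List Carrier ] length ys ≡ 3 × sumOfSquares xs ≈ sumOfSquares ys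
    sumOfSquares≈sumOfThreeSquares xs =
      threeSquares 1+α²+β²≈0 2+β²+2γ≈0 (σ₁ xs) (σ₂ xs) ,
      ≡.refl ,
      trans (sumOfSquares≈σ₁²-2σ₂ xs) (sym (sumOfSquares-threeSquares 1+α²+β²≈0 2+β²+2γ≈0 (σ₁ xs) (σ₂ xs)))

module TwoAdic where

  open import Data.Bool using (Bool; true; false; if_then_else_; not)
  open import Data.Nat as ℕ using (zero; suc; _+_; _*_; _^_; _%_; _<_; NonZero; ⌊_/2⌋; z≤n; s≤s)
  open import Data.Nat.Properties using (m^n≢0; m*n≢0; +-identityʳ; +-monoˡ-<; ≤-trans; ≤-reflexive; m≤m+n; +-cancelˡ-≡)
  import Data.Nat.Properties as ℕ
  open import Data.Nat.DivMod
    using ( %-congʳ; %-distribˡ-+; %-distribˡ-*; m%n<n; n%1≡0; n%n≡0; m*n%n≡0; m<n⇒m%n≡m; [m+n]%n≡m%n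
          ; m%n*o≡m*o%[n*o]; [m*n+o]%[p*n]≡[m*n]%[p*n]+o )
  open import Data.Nat.Tactic.RingSolver using (solve-∀)
  open import Relation.Binary.PropositionalEquality
  open import Relation.Nullary using (contradiction)
  open import Relation.Binary.Bundles using (Setoid)
  open import Relation.Binary.Structures using (IsEquivalence)
  open import Algebra.Structures using (IsCommutativeRing)
  open import Algebra.Definitions
  open import Algebra.Consequences.Setoid using (comm∧idˡ⇒id; comm∧invʳ⇒inv; comm∧distrˡ⇒distr)
  open import Level using (0ℓ)
  open ≡-Reasoning

  -- Instance search cannot find NonZero (2 ^ n) for a variable n, so the residue
  -- modulo 2ⁿ gets a name of its own that supplies the instance once.
  infixl 7 _%2^_

  _%2^_ : ℕ → ℕ → ℕ
  m %2^ n = _%_ m (2 ^ n) {{m^n≢0 2 n}}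

  digit : Bool → ℕ → ℕ
  digit b n = if b then 2 ^ n else 0

  m≡⌊m/2⌋*2+m%2 : ∀ m → m ≡ ⌊ m /2⌋ * 2 + m % 2
  m≡⌊m/2⌋*2+m%2 0             = refl
  m≡⌊m/2⌋*2+m%2 1             = refl
  m≡⌊m/2⌋*2+m%2 (suc (suc m)) = trans (cong (2 +_) (m≡⌊m/2⌋*2+m%2 m)) (regroup ⌊ m /2⌋ (m % 2))
    where
    regroup : ∀ h r → 2 + (h * 2 + r) ≡ suc h * 2 + r
    regroup = solve-∀

  m%2^[1+n] : ∀ m n → m %2^ suc n ≡ ⌊ m /2⌋ %2^ n * 2 + m % 2
  m%2^[1+n] m n = begin
    m %2^ suc n                      ≡⟨ %-congʳ {o = m} (ℕ.*-comm 2 (2 ^ n)) ⟩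
    m % (2 ^ n * 2)                  ≡⟨ cong (_% (2 ^ n * 2)) (m≡⌊m/2⌋*2+m%2 m) ⟩
    (h * 2 + m % 2) % (2 ^ n * 2)    ≡⟨ [m*n+o]%[p*n]≡[m*n]%[p*n]+o h (2 ^ n) (m%n<n m 2) ⟩
    h * 2 % (2 ^ n * 2) + m % 2      ≡⟨ cong (_+ m % 2) (m%n*o≡m*o%[n*o] h (2 ^ n) 2) ⟨
    h % 2 ^ n * 2 + m % 2            ∎
    where
    h = ⌊ m /2⌋
    instance
      2^n≢0 : NonZero (2 ^ n)
      2^n≢0 = m^n≢0 2 n
      2^n*2≢0 : NonZero (2 ^ n * 2)
      2^n*2≢0 = m*n≢0 (2 ^ n) 2
      2^[1+n]≢0 : NonZero (2 ^ suc n)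
      2^[1+n]≢0 = m^n≢0 2 (suc n)

  m%2^[1+n]≡m%2^n+digit : ∀ m n → m %2^ suc n ≡ m %2^ n + digit (bitAt m n) n
  m%2^[1+n]≡m%2^n+digit m zero    = trans (lowest (m % 2) (m%n<n m 2)) (cong (_+ digit (bitAt m 0) 0) (sym (n%1≡0 m)))
    where
    lowest : ∀ r → r < 2 → r ≡ 0 + digit (r ℕ.≡ᵇ 1) 0
    lowest 0 _ = refl
    lowest 1 _ = refl
    lowest (suc (suc _)) (s≤s (s≤s ()))
  m%2^[1+n]≡m%2^n+digit m (suc n) = begin
    m %2^ suc (suc n)                      ≡⟨ m%2^[1+n] m (suc n) ⟩
    h %2^ suc n * 2 + m % 2                ≡⟨ cong (λ k → k * 2 + m % 2) (m%2^[1+n]≡m%2^n+digit h n) ⟩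
    (h %2^ n + digit b n) * 2 + m % 2      ≡⟨ regroup (h %2^ n) (digit b n) (m % 2) ⟩
    (h %2^ n * 2 + m % 2) + digit b n * 2  ≡⟨ cong₂ _+_ (m%2^[1+n] m n) (double b) ⟨
    m %2^ suc n + digit b (suc n)          ∎
    where
    h = ⌊ m /2⌋
    b = bitAt h n
    regroup : ∀ a d r → (a + d) * 2 + r ≡ (a * 2 + r) + d * 2
    regroup = solve-∀
    double : ∀ b → digit b (suc n) ≡ digit b n * 2
    double true  = ℕ.*-comm 2 (2 ^ n)
    double false = refl

  approx<2^n : ∀ x n → approx x n < 2 ^ n
  approx<2^n x zero    = s≤s z≤n
  approx<2^n x (suc n) with x n
  ... | true  = ≤-trans (+-monoˡ-< (2 ^ n) (approx<2^n x n)) (≤-reflexive (cong (2 ^ n +_) (sym (+-identityʳ (2 ^ n)))))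
  ... | false = ≤-trans (≤-reflexive (cong suc (+-identityʳ _))) (≤-trans (approx<2^n x n) (m≤m+n (2 ^ n) _))

  approx-%2^ : ∀ x n → approx x n %2^ n ≡ approx x n
  approx-%2^ x n = m<n⇒m%n≡m {{m^n≢0 2 n}} (approx<2^n x n)

  Compatible : (ℕ → ℕ) → Set
  Compatible g = ∀ n → g (suc n) %2^ n ≡ g n %2^ n

  approx-compatible : ∀ x → Compatible (approx x)
  approx-compatible x n = drop-digit (x n)
    where
    drop-digit : ∀ b → (approx x n + digit b n) %2^ n ≡ approx x n %2^ n
    drop-digit true  = [m+n]%n≡m%n (approx x n) (2 ^ n) {{m^n≢0 2 n}}
    drop-digit false = cong (_%2^ n) (+-identityʳ (approx x n))

  approx-injective : ∀ {x y} → (∀ n → approx x n ≡ approx y n) → x ≈ℤ₂ y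
  approx-injective {x} {y} eq n =
    digit-injective (x n) (y n) (+-cancelˡ-≡ (approx x n) _ _ (trans (eq (suc n)) (cong (_+ digit (y n) n) (sym (eq n)))))
    where
    2^n≢0 : 2 ^ n ≢ 0
    2^n≢0 = ℕ.≢-nonZero⁻¹ (2 ^ n) {{m^n≢0 2 n}}
    digit-injective : ∀ a b → digit a n ≡ digit b n → a ≡ b
    digit-injective true  true  _  = refl
    digit-injective false false _  = refl
    digit-injective true  false eq = contradiction eq 2^n≢0
    digit-injective false true  eq = contradiction (sym eq) 2^n≢0

  approx-cong : ∀ {x y} → x ≈ℤ₂ y → ∀ n → approx x n ≡ approx y n
  approx-cong x≈y zero    = refl
  approx-cong x≈y (suc n) = cong₂ (λ a b → a + digit b n) (approx-cong x≈y n) (x≈y n)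

  approx-0ℤ₂ : ∀ n → approx 0ℤ₂ n ≡ 0
  approx-0ℤ₂ zero    = refl
  approx-0ℤ₂ (suc n) = trans (+-identityʳ _) (approx-0ℤ₂ n)

  Residues : ℤ₂ → (ℕ → ℕ) → Set
  Residues x g = ∀ n → approx x n ≡ g n %2^ n

  residues-approx : ∀ x → Residues x (approx x)
  residues-approx x n = sym (approx-%2^ x n)

  residues-lift : ∀ g → Compatible g → Residues (lift g) g
  residues-lift g compatible zero    = sym (n%1≡0 (g 0))
  residues-lift g compatible (suc n) = begin
    approx (lift g) n + digit b n  ≡⟨ cong (_+ digit b n) (residues-lift g compatible n) ⟩
    g n %2^ n + digit b n          ≡⟨ cong (_+ digit b n) (compatible n) ⟨
    g (suc n) %2^ n + digit b n    ≡⟨ m%2^[1+n]≡m%2^n+digit (g (suc n)) n ⟨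
    g (suc n) %2^ suc n            ∎
    where
    b = bitAt (g (suc n)) n

  residues-cong : ∀ {x g h} → (∀ n → g n ≡ h n) → Residues x g → Residues x h
  residues-cong g≡h rx n = trans (rx n) (cong (_%2^ n) (g≡h n))

  residues-injective : ∀ {x y g h} → Residues x g → Residues y h → (∀ n → g n %2^ n ≡ h n %2^ n) → x ≈ℤ₂ y
  residues-injective rx ry g≡h = approx-injective λ n → trans (rx n) (trans (g≡h n) (sym (ry n)))

  residues-unique : ∀ {x y g h} → Residues x g → Residues y h → (∀ n → g n ≡ h n) → x ≈ℤ₂ y
  residues-unique rx ry g≡h = residues-injective rx ry (λ n → cong (_%2^ n) (g≡h n))

  private
    approx≡residue : ∀ {x g} → Residues x g → ∀ n → approx x n %2^ n ≡ g n %2^ n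
    approx≡residue {x} rx n = trans (approx-%2^ x n) (rx n)

  module _ (_∙_ : ℕ → ℕ → ℕ) (%-distrib-∙ : ∀ a b M .{{_ : NonZero M}} → (a ∙ b) % M ≡ ((a % M) ∙ (b % M)) % M) where

    private
      ∙-cong-% : ∀ M .{{_ : NonZero M}} a a′ b b′ → a % M ≡ a′ % M → b % M ≡ b′ % M → (a ∙ b) % M ≡ (a′ ∙ b′) % M
      ∙-cong-% M a a′ b b′ a≡a′ b≡b′ = begin
        (a ∙ b) % M                 ≡⟨ %-distrib-∙ a b M ⟩
        ((a % M) ∙ (b % M)) % M     ≡⟨ cong₂ (λ u v → (u ∙ v) % M) a≡a′ b≡b′ ⟩
        ((a′ % M) ∙ (b′ % M)) % M   ≡⟨ %-distrib-∙ a′ b′ M ⟨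
        (a′ ∙ b′) % M               ∎

    residues-lift₂ : ∀ {x y g h} → Residues x g → Residues y h →
                     Residues (lift (λ n → approx x n ∙ approx y n)) (λ n → g n ∙ h n)
    residues-lift₂ {x} {y} {g} {h} rx ry n = trans
      (residues-lift (λ n → approx x n ∙ approx y n) compatible n)
      (∙-cong-% (2 ^ n) {{m^n≢0 2 n}} (approx x n) (g n) (approx y n) (h n) (approx≡residue rx n) (approx≡residue ry n))
      where
      compatible : Compatible (λ n → approx x n ∙ approx y n)
      compatible n = ∙-cong-% (2 ^ n) {{m^n≢0 2 n}} (approx x (suc n)) (approx x n) (approx y (suc n)) (approx y n)
                       (approx-compatible x n) (approx-compatible y n)

  infixl 6 _⟨+⟩_
  infixl 7 _⟨*⟩_

  _⟨+⟩_ : ∀ {x y g h} → Residues x g → Residues y h → Residues (x +ℤ₂ y) (λ n → g n + h n)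
  _⟨+⟩_ = residues-lift₂ _+_ %-distribˡ-+

  _⟨*⟩_ : ∀ {x y g h} → Residues x g → Residues y h → Residues (x *ℤ₂ y) (λ n → g n * h n)
  _⟨*⟩_ = residues-lift₂ _*_ %-distribˡ-*

  residues-0 : Residues 0ℤ₂ (λ _ → 0)
  residues-0 n = trans (approx-0ℤ₂ n) (sym (m*n%n≡0 0 (2 ^ n) {{m^n≢0 2 n}}))

  residues-≈0 : ∀ {x g} → Residues x g → (∀ n → g n %2^ n ≡ 0) → x ≈ℤ₂ 0ℤ₂
  residues-≈0 rx g≡0 = approx-injective λ n → trans (rx n) (trans (g≡0 n) (sym (approx-0ℤ₂ n)))

  1ℤ₂ : ℤ₂
  1ℤ₂ = lift (λ _ → 1)

  residues-1 : Residues 1ℤ₂ (λ _ → 1)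
  residues-1 = residues-lift (λ _ → 1) (λ _ → refl)

  complement : ℤ₂ → ℤ₂
  complement x n = not (x n)

  approx-complement : ∀ x n → approx (complement x) n + approx x n + 1 ≡ 2 ^ n
  approx-complement x zero    = refl
  approx-complement x (suc n) = begin
    (c + digit (not (x n)) n) + (a + digit (x n) n) + 1  ≡⟨ regroup c a (digit (x n) n) (digit (not (x n)) n) ⟩
    (c + a + 1) + (digit (x n) n + digit (not (x n)) n)  ≡⟨ cong₂ _+_ (approx-complement x n) (digit+digit-not (x n)) ⟩
    2 ^ n + 2 ^ n                                        ≡⟨ cong (2 ^ n +_) (+-identityʳ (2 ^ n)) ⟨
    2 ^ suc n                                            ∎
    where
    c = approx (complement x) n
    a = approx x n
    regroup : ∀ c a d d′ → (c + d′) + (a + d) + 1 ≡ (c + a + 1) + (d + d′)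
    regroup = solve-∀
    digit+digit-not : ∀ b → digit b n + digit (not b) n ≡ 2 ^ n
    digit+digit-not true  = +-identityʳ (2 ^ n)
    digit+digit-not false = refl

  -ℤ₂_ : ℤ₂ → ℤ₂
  -ℤ₂ x = complement x +ℤ₂ 1ℤ₂

  ℤ₂-isCommutativeRing : IsCommutativeRing _≈ℤ₂_ _+ℤ₂_ _*ℤ₂_ -ℤ₂_ 0ℤ₂ 1ℤ₂
  ℤ₂-isCommutativeRing = record
    { isRing = record
      { +-isAbelianGroup = record
        { isGroup = record
          { isMonoid = record
            { isSemigroup = record
              { isMagma = record { isEquivalence = ≈-isEquivalence ; ∙-cong = +-cong }
              ; assoc   = +-assoc
              }
            ; identity = comm∧idˡ⇒id ℤ₂-setoid +-comm +-identityˡ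
            }
          ; inverse = comm∧invʳ⇒inv ℤ₂-setoid +-comm -‿inverseʳ
          ; ⁻¹-cong = -‿cong
          }
        ; comm = +-comm
        }
      ; *-cong     = *-cong
      ; *-assoc    = *-assoc
      ; *-identity = comm∧idˡ⇒id ℤ₂-setoid *-comm *-identityˡ
      ; distrib    = comm∧distrˡ⇒distr ℤ₂-setoid +-cong *-comm distribˡ
      }
    ; *-comm = *-comm
    }
    where
    res = residues-approx

    ≈-isEquivalence : IsEquivalence _≈ℤ₂_
    ≈-isEquivalence = record
      { refl  = λ _ → refl
      ; sym   = λ x≈y n → sym (x≈y n)
      ; trans = λ x≈y y≈z n → trans (x≈y n) (y≈z n)
      }

    ℤ₂-setoid : Setoid 0ℓ 0ℓ
    ℤ₂-setoid = record { isEquivalence = ≈-isEquivalence }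

    +-cong : Congruent₂ _≈ℤ₂_ _+ℤ₂_
    +-cong {x} {x′} {y} {y′} x≈x′ y≈y′ = residues-unique (res x ⟨+⟩ res y) (res x′ ⟨+⟩ res y′)
      (λ n → cong₂ _+_ (approx-cong x≈x′ n) (approx-cong y≈y′ n))

    *-cong : Congruent₂ _≈ℤ₂_ _*ℤ₂_
    *-cong {x} {x′} {y} {y′} x≈x′ y≈y′ = residues-unique (res x ⟨*⟩ res y) (res x′ ⟨*⟩ res y′)
      (λ n → cong₂ _*_ (approx-cong x≈x′ n) (approx-cong y≈y′ n))

    -‿cong : Congruent₁ _≈ℤ₂_ -ℤ₂_
    -‿cong x≈y = +-cong (λ n → cong not (x≈y n)) (λ _ → refl)

    +-assoc : Associative _≈ℤ₂_ _+ℤ₂_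
    +-assoc x y z = residues-unique (res x ⟨+⟩ res y ⟨+⟩ res z) (res x ⟨+⟩ (res y ⟨+⟩ res z))
      (λ n → ℕ.+-assoc (approx x n) (approx y n) (approx z n))

    *-assoc : Associative _≈ℤ₂_ _*ℤ₂_
    *-assoc x y z = residues-unique (res x ⟨*⟩ res y ⟨*⟩ res z) (res x ⟨*⟩ (res y ⟨*⟩ res z))
      (λ n → ℕ.*-assoc (approx x n) (approx y n) (approx z n))

    +-comm : Commutative _≈ℤ₂_ _+ℤ₂_
    +-comm x y = residues-unique (res x ⟨+⟩ res y) (res y ⟨+⟩ res x) (λ n → ℕ.+-comm (approx x n) (approx y n))

    *-comm : Commutative _≈ℤ₂_ _*ℤ₂_
    *-comm x y = residues-unique (res x ⟨*⟩ res y) (res y ⟨*⟩ res x) (λ n → ℕ.*-comm (approx x n) (approx y n))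

    +-identityˡ : LeftIdentity _≈ℤ₂_ 0ℤ₂ _+ℤ₂_
    +-identityˡ x = residues-unique (residues-0 ⟨+⟩ res x) (res x) (λ n → refl)

    *-identityˡ : LeftIdentity _≈ℤ₂_ 1ℤ₂ _*ℤ₂_
    *-identityˡ x = residues-unique (residues-1 ⟨*⟩ res x) (res x) (λ n → ℕ.*-identityˡ (approx x n))

    distribˡ : _DistributesOverˡ_ _≈ℤ₂_ _*ℤ₂_ _+ℤ₂_
    distribˡ x y z = residues-unique (res x ⟨*⟩ (res y ⟨+⟩ res z)) (res x ⟨*⟩ res y ⟨+⟩ res x ⟨*⟩ res z)
      (λ n → ℕ.*-distribˡ-+ (approx x n) (approx y n) (approx z n))

    -‿inverseʳ : RightInverse _≈ℤ₂_ 0ℤ₂ -ℤ₂_ _+ℤ₂_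
    -‿inverseʳ x = residues-≈0 (res x ⟨+⟩ (res (complement x) ⟨+⟩ residues-1)) λ n → begin
      (approx x n + (approx (complement x) n + 1)) %2^ n  ≡⟨ cong (_%2^ n) (regroup (approx x n) (approx (complement x) n)) ⟩
      (approx (complement x) n + approx x n + 1) %2^ n    ≡⟨ cong (_%2^ n) (approx-complement x n) ⟩
      2 ^ n %2^ n                                         ≡⟨ n%n≡0 (2 ^ n) {{m^n≢0 2 n}} ⟩
      0                                                   ∎
      where
      regroup : ∀ a c → a + (c + 1) ≡ c + a + 1
      regroup = solve-∀

  ℤ₂-commutativeRing : CommutativeRing 0ℓ 0ℓ
  ℤ₂-commutativeRing = record { isCommutativeRing = ℤ₂-isCommutativeRing }

module ℤ₂ where
  open TwoAdic using (ℤ₂-commutativeRing)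
  open CommutativeRing ℤ₂-commutativeRing public
  open IntegerCoefficients ℤ₂-commutativeRing public using (fromℕ)

module Hensel where

  open import Data.Nat as ℕ using (zero; suc; _+_; _*_; _^_; _%_; _<_; ⌊_/2⌋; s≤s)
  open import Data.Nat.Properties using (m^n≢0)
  import Data.Nat.Properties as ℕ
  open import Data.Nat.DivMod using (m%n<n; [m+kn]%n≡m%n; m*n%n≡0)
  open import Data.Nat.Tactic.RingSolver using (solve-∀)
  open import Data.Product using (Σ-syntax; _×_; _,_; proj₁; proj₂)
  open import Relation.Binary.PropositionalEquality
  open ≡-Reasoning
  open TwoAdic

  open ℤ₂ using (fromℕ)

  residues-fromℕ : ∀ k → Residues (fromℕ k) (λ _ → k)
  residues-fromℕ 0             = residues-0
  residues-fromℕ 1             = residues-1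
  residues-fromℕ (suc (suc k)) = residues-cong (λ _ → ℕ.+-comm (suc k) 1) (residues-fromℕ (suc k) ⟨+⟩ residues-1)

  F : ℕ → ℕ
  F a = 19 * ((2 * a + 1) * (2 * a + 1)) + 5

  -- approximateRoot k = (a , q) with F a = 2^(k+3) q.  When q is odd, replacing 2a + 1
  -- by 2a + 1 + 2^(k+2) makes F divisible by one more power of 2.
  henselStep : ℕ → ℕ → ℕ → ℕ → ℕ × ℕ
  henselStep k a q zero    = a , ⌊ q /2⌋
  henselStep k a q (suc _) = a + 2 * 2 ^ k , ⌊ q /2⌋ + 19 * a + 10 + 19 * 2 ^ k

  approximateRoot : ℕ → ℕ × ℕ
  approximateRoot zero    = 0 , 3
  approximateRoot (suc k) = henselStep k a q (q % 2)
    where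
    a = proj₁ (approximateRoot k)
    q = proj₂ (approximateRoot k)

  henselStep-invariant : ∀ k a q r → r < 2 → q ≡ ⌊ q /2⌋ * 2 + r → F a ≡ 2 ^ k * 8 * q →
                         F (proj₁ (henselStep k a q r)) ≡ 2 ^ suc k * 8 * proj₂ (henselStep k a q r)
  henselStep-invariant k a q zero _ q≡ Fa≡ = begin
    F a                      ≡⟨ Fa≡ ⟩
    p * 8 * q                ≡⟨ cong (p * 8 *_) q≡ ⟩
    p * 8 * (h * 2 + 0)      ≡⟨ regroup p h ⟩
    2 * p * 8 * h            ∎
    where
    p = 2 ^ k
    h = ⌊ q /2⌋
    regroup : ∀ p h → p * 8 * (h * 2 + 0) ≡ 2 * p * 8 * h
    regroup = solve-∀
  henselStep-invariant k a q 1 _ q≡ Fa≡ = begin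
    F (a + 2 * p)                                  ≡⟨ expand a p ⟩
    F a + p * 8 * g                                ≡⟨ cong (_+ p * 8 * g) (trans Fa≡ (cong (p * 8 *_) q≡)) ⟩
    p * 8 * (h * 2 + 1) + p * 8 * g                ≡⟨ collect p h a ⟩
    2 * p * 8 * (h + 19 * a + 10 + 19 * p)         ∎
    where
    p = 2 ^ k
    h = ⌊ q /2⌋
    g = 19 * (2 * a + 1) + 38 * p
    expand : ∀ a p → 19 * ((2 * (a + 2 * p) + 1) * (2 * (a + 2 * p) + 1)) + 5
                     ≡ 19 * ((2 * a + 1) * (2 * a + 1)) + 5 + p * 8 * (19 * (2 * a + 1) + 38 * p)
    expand = solve-∀
    collect : ∀ p h a → p * 8 * (h * 2 + 1) + p * 8 * (19 * (2 * a + 1) + 38 * p) ≡ 2 * p * 8 * (h + 19 * a + 10 + 19 * p)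
    collect = solve-∀
  henselStep-invariant k a q (suc (suc _)) (s≤s (s≤s ()))

  approximateRoot-invariant : ∀ k → F (proj₁ (approximateRoot k)) ≡ 2 ^ k * 8 * proj₂ (approximateRoot k)
  approximateRoot-invariant zero    = refl
  approximateRoot-invariant (suc k) =
    henselStep-invariant k a q (q % 2) (m%n<n q 2) (m≡⌊m/2⌋*2+m%2 q) (approximateRoot-invariant k)
    where
    a = proj₁ (approximateRoot k)
    q = proj₂ (approximateRoot k)

  root : ℕ → ℕ
  root k = 2 * proj₁ (approximateRoot k) + 1

  root-compatible : Compatible root
  root-compatible k = step-compatible a q (q % 2)
    where
    a = proj₁ (approximateRoot k)
    q = proj₂ (approximateRoot k)
    step-compatible : ∀ a q r → (2 * proj₁ (henselStep k a q r) + 1) %2^ k ≡ (2 * a + 1) %2^ k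
    step-compatible a q zero    = refl
    step-compatible a q (suc _) = begin
      (2 * (a + 2 * 2 ^ k) + 1) %2^ k   ≡⟨ cong (_%2^ k) (regroup a (2 ^ k)) ⟩
      (2 * a + 1 + 4 * 2 ^ k) %2^ k     ≡⟨ [m+kn]%n≡m%n (2 * a + 1) 4 (2 ^ k) {{m^n≢0 2 k}} ⟩
      (2 * a + 1) %2^ k                 ∎
      where
      regroup : ∀ a p → 2 * (a + 2 * p) + 1 ≡ 2 * a + 1 + 4 * p
      regroup = solve-∀

  √-5/19 : Σ[ c ∈ ℤ₂ ] ℤ₂.fromℕ 19 ℤ₂.* (c ℤ₂.* c) ℤ₂.+ ℤ₂.fromℕ 5 ℤ₂.≈ ℤ₂.0#
  √-5/19 = lift root , residues-≈0 (residues-fromℕ 19 ⟨*⟩ (rc ⟨*⟩ rc) ⟨+⟩ residues-fromℕ 5) divisible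
    where
    rc = residues-lift root root-compatible
    divisible : ∀ n → F (proj₁ (approximateRoot n)) %2^ n ≡ 0
    divisible n = begin
      F (proj₁ (approximateRoot n)) %2^ n           ≡⟨ cong (_%2^ n) (approximateRoot-invariant n) ⟩
      2 ^ n * 8 * proj₂ (approximateRoot n) %2^ n   ≡⟨ cong (_%2^ n) (regroup (2 ^ n) (proj₂ (approximateRoot n))) ⟩
      8 * proj₂ (approximateRoot n) * 2 ^ n %2^ n   ≡⟨ m*n%n≡0 (8 * proj₂ (approximateRoot n)) (2 ^ n) {{m^n≢0 2 n}} ⟩
      0                                             ∎
      where
      regroup : ∀ p q → p * 8 * q ≡ 8 * q * p
      regroup = solve-∀

module CommutativeMonoidSums {c ℓ} (M : CommutativeMonoid c ℓ) where

  open import Data.Fin using (Fin; zero; suc; punchIn)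
  open import Data.Fin.Properties using (punchInᵢ≢i)
  open import Data.Nat using (zero; suc)
  import Data.Nat.Properties as ℕ
  open import Function using (_∘_)
  open import Relation.Binary.PropositionalEquality using (_≢_)

  open CommutativeMonoid M renaming (_∙_ to _+_; ε to 0#; ∙-congˡ to +-congˡ; identityʳ to +-identityʳ)
  open import Algebra.Properties.CommutativeMonoid.Sum M
  open import Algebra.Properties.CommutativeMonoid.Mult M using (_×_; ×-assocˡ; ×-congˡ; ×-distrib-+)
  open import Relation.Binary.Reasoning.Setoid setoid

  sum-≈0 : ∀ {n} {f : Fin n → Carrier} → (∀ i → f i ≈ 0#) → sum f ≈ 0#
  sum-≈0 {n} f≈0 = trans (sum-cong-≋ f≈0) (sum-replicate-zero n)

  sum-δ : ∀ {n} (f : Fin (suc n) → Carrier) i → (∀ j → j ≢ i → f j ≈ 0#) → sum f ≈ f i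
  sum-δ f i f≈0 = begin
    sum f                              ≈⟨ sum-remove f ⟩
    f i + sum (λ j → f (punchIn i j))  ≈⟨ +-congˡ (sum-≈0 λ j → f≈0 (punchIn i j) (punchInᵢ≢i i j)) ⟩
    f i + 0#                           ≈⟨ +-identityʳ (f i) ⟩
    f i                                ∎

  ×-zeroʳ : ∀ n → n × 0# ≈ 0#
  ×-zeroʳ n = trans (×-assocˡ 0# n 0) (×-congˡ (ℕ.*-zeroʳ n))

  ×-distrib-sum : ∀ {k} n (f : Fin k → Carrier) → n × sum f ≈ sum (λ i → n × f i)
  ×-distrib-sum {zero}  n f = ×-zeroʳ n
  ×-distrib-sum {suc k} n f = trans (×-distrib-+ (f zero) (sum (f ∘ suc)) n) (+-congˡ (×-distrib-sum n (f ∘ suc)))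

  ∑-rotate₃ : ∀ {n} (f : Fin n → Fin n → Fin n → Carrier) →
              ∑[ a < n ] (∑[ j < n ] (∑[ l < n ] f a j l)) ≈ ∑[ j < n ] (∑[ l < n ] (∑[ a < n ] f a j l))
  ∑-rotate₃ f = trans (∑-comm (λ a j → ∑[ l < _ ] f a j l)) (sum-cong-≋ λ j → ∑-comm (λ a l → f a j l))

  ∑-reverse₃ : ∀ {n} (f : Fin n → Fin n → Fin n → Carrier) →
               ∑[ i < n ] (∑[ j < n ] (∑[ l < n ] f i j l)) ≈ ∑[ l < n ] (∑[ j < n ] (∑[ i < n ] f i j l))
  ∑-reverse₃ f = begin
    ∑[ i < _ ] (∑[ j < _ ] (∑[ l < _ ] f i j l))  ≈⟨ sum-cong-≋ (λ i → ∑-comm (f i)) ⟩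
    ∑[ i < _ ] (∑[ l < _ ] (∑[ j < _ ] f i j l))  ≈⟨ ∑-comm (λ i l → ∑[ j < _ ] f i j l) ⟩
    ∑[ l < _ ] (∑[ i < _ ] (∑[ j < _ ] f i j l))  ≈⟨ sum-cong-≋ (λ l → ∑-comm (λ i j → f i j l)) ⟩
    ∑[ l < _ ] (∑[ j < _ ] (∑[ i < _ ] f i j l))  ∎

module PowersOfT (m : ℕ) where

  open import Data.Bool using (true; false; if_then_else_)
  open import Data.Fin using (Fin; toℕ)
  open import Data.Fin.Properties using (toℕ<n; toℕ-injective; toℕ-fromℕ<)
  open import Data.Nat as ℕ using (suc; _+_; _*_; _∸_; _^_; _%_; _/_; _<_; _≡ᵇ_)
  import Data.Nat.Properties as ℕ
  open import Data.Nat.DivMod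
    using (_mod_; m%n<n; [m+kn]%n≡m%n; +-distrib-/-∣ʳ; m*n/n≡m; m<n⇒m%n≡m; m<n⇒m/n≡0; m≡m%n+[m/n]*n)
  open import Data.Nat.Divisibility using (n∣m*n)
  open import Function using (_∘_)
  open import Relation.Binary.PropositionalEquality as ≡ using (_≡_; _≢_)
  open import Relation.Nullary using (Dec; yes; no)
  open import Relation.Nullary.Decidable using (dec-true; dec-false)

  e : ℕ
  e = suc m

  -- The coefficient of tᵏ in tˢ = 2^(s / e) t^(s % e).
  coeff : ℕ → Fin e → ℕ
  coeff s k = if s % e ≡ᵇ toℕ k then 2 ^ (s / e) else 0

  coeff-off : ∀ s k → s % e ≢ toℕ k → coeff s k ≡ 0
  coeff-off s k ne rewrite dec-false (s % e ℕ.≟ toℕ k) ne = ≡.refl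

  coeff-on : ∀ s k → s % e ≡ toℕ k → coeff s k ≡ 2 ^ (s / e)
  coeff-on s k eq rewrite dec-true (s % e ℕ.≟ toℕ k) eq = ≡.refl

  coeff-shift : ∀ s q k → coeff (s + q * e) k ≡ 2 ^ q * coeff s k
  coeff-shift s q k = ≡.trans
    (≡.cong₂ (λ r d → if r ≡ᵇ toℕ k then 2 ^ d else 0)
      ([m+kn]%n≡m%n s q e)
      (≡.trans (+-distrib-/-∣ʳ s (n∣m*n q)) (≡.cong (s / e +_) (m*n/n≡m q e))))
    (scale (s % e ≡ᵇ toℕ k))
    where
    scale : ∀ b → (if b then 2 ^ (s / e + q) else 0) ≡ 2 ^ q * (if b then 2 ^ (s / e) else 0)
    scale true  = ≡.trans (ℕ.^-distribˡ-+-* 2 (s / e) q) (ℕ.*-comm (2 ^ (s / e)) (2 ^ q))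
    scale false = ≡.sym (ℕ.*-zeroʳ (2 ^ q))

  coeff-< : ∀ s k → s < e → coeff s k ≡ (if s ≡ᵇ toℕ k then 1 else 0)
  coeff-< s k s<e = ≡.cong₂ (λ r d → if r ≡ᵇ toℕ k then 2 ^ d else 0) (m<n⇒m%n≡m s<e) (m<n⇒m/n≡0 s<e)

  coeff-diagonal : ∀ k → coeff (toℕ k) k ≡ 1
  coeff-diagonal k = ≡.trans (coeff-< (toℕ k) k (toℕ<n k)) (≡.cong (λ b → if b then 1 else 0) (dec-true (toℕ k ℕ.≟ toℕ k) ≡.refl))

  coeff-offDiagonal : ∀ {j k} → j ≢ k → coeff (toℕ j) k ≡ 0
  coeff-offDiagonal {j} {k} j≢k = ≡.trans (coeff-< (toℕ j) k (toℕ<n j))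
    (≡.cong (λ b → if b then 1 else 0) (dec-false (toℕ j ℕ.≟ toℕ k) (j≢k ∘ toℕ-injective)))

  coeff-mod : ∀ s → coeff s (s mod e) ≡ 2 ^ (s / e)
  coeff-mod s = coeff-on s (s mod e) (≡.sym (toℕ-fromℕ< (m%n<n s e)))

  coeff-off-mod : ∀ s a → a ≢ s mod e → coeff s a ≡ 0
  coeff-off-mod s a a≢s = coeff-off s a λ eq → a≢s (toℕ-injective (≡.trans (≡.sym eq) (≡.sym (toℕ-fromℕ< (m%n<n s e)))))

  coeff-chain : ∀ i s k → coeff (i + toℕ (s mod e)) k * 2 ^ (s / e) ≡ coeff (i + s) k
  coeff-chain i s k = begin
    coeff (i + toℕ (s mod e)) k * 2 ^ (s / e)  ≡⟨ ≡.cong (λ r → coeff (i + r) k * 2 ^ (s / e)) (toℕ-fromℕ< (m%n<n s e)) ⟩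
    coeff (i + s % e) k * 2 ^ (s / e)          ≡⟨ ℕ.*-comm _ (2 ^ (s / e)) ⟩
    2 ^ (s / e) * coeff (i + s % e) k          ≡⟨ coeff-shift (i + s % e) (s / e) k ⟨
    coeff (i + s % e + s / e * e) k            ≡⟨ ≡.cong (λ r → coeff r k) (ℕ.+-assoc i (s % e) (s / e * e)) ⟩
    coeff (i + (s % e + s / e * e)) k          ≡⟨ ≡.cong (λ r → coeff (i + r) k) (m≡m%n+[m/n]*n s e) ⟨
    coeff (i + s) k                            ∎
    where open ≡.≡-Reasoning

  coeff-<2e : ∀ s k → s < e + e →
              coeff s k ≡ (if s ≡ᵇ toℕ k then 1 else if s ≡ᵇ toℕ k + e then 2 else 0)
  coeff-<2e s k s<2e with s ℕ.<? e
  ... | yes s<e = ≡.trans (coeff-< s k s<e) (≡.cong (λ b → if s ≡ᵇ toℕ k then 1 else if b then 2 else 0) (≡.sym s≢k+e))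
    where
    s≢k+e : (s ≡ᵇ toℕ k + e) ≡ false
    s≢k+e = dec-false (s ℕ.≟ toℕ k + e) λ eq → ℕ.<-irrefl eq (ℕ.<-≤-trans s<e (ℕ.m≤n+m e (toℕ k)))
  ... | no s≮e = begin
    coeff s k                                                    ≡⟨ ≡.cong (λ s → coeff s k) s≡r+1*e ⟩
    coeff (r + 1 * e) k                                          ≡⟨ coeff-shift r 1 k ⟩
    2 * coeff r k                                                ≡⟨ ≡.cong (2 *_) (coeff-< r k r<e) ⟩
    2 * (if r ≡ᵇ toℕ k then 1 else 0)                            ≡⟨ doubled (r ℕ.≟ toℕ k) ⟩
    (if s ≡ᵇ toℕ k then 1 else if s ≡ᵇ toℕ k + e then 2 else 0)  ∎
    where
    open ≡.≡-Reasoning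
    r = s ∸ e
    s≡r+e : s ≡ r + e
    s≡r+e = ≡.sym (ℕ.m∸n+n≡m (ℕ.≮⇒≥ s≮e))
    s≡r+1*e : s ≡ r + 1 * e
    s≡r+1*e = ≡.trans s≡r+e (≡.cong (r +_) (≡.sym (ℕ.*-identityˡ e)))
    r<e : r < e
    r<e = ℕ.+-cancelʳ-< e r e (≡.subst (_< e + e) s≡r+e s<2e)
    s≢k : (s ≡ᵇ toℕ k) ≡ false
    s≢k = dec-false (s ℕ.≟ toℕ k) λ eq → s≮e (≡.subst (_< e) (≡.sym eq) (toℕ<n k))
    doubled : Dec (r ≡ toℕ k) → 2 * (if r ≡ᵇ toℕ k then 1 else 0) ≡ (if s ≡ᵇ toℕ k then 1 else if s ≡ᵇ toℕ k + e then 2 else 0)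
    doubled (yes r≡k) rewrite dec-true (r ℕ.≟ toℕ k) r≡k | s≢k | dec-true (s ℕ.≟ toℕ k + e) (≡.trans s≡r+e (≡.cong (_+ e) r≡k)) = ≡.refl
    doubled (no r≢k) rewrite dec-false (r ℕ.≟ toℕ k) r≢k | s≢k | dec-false (s ℕ.≟ toℕ k + e) (λ eq → r≢k (ℕ.+-cancelʳ-≡ e r (toℕ k) (≡.trans (≡.sym s≡r+e) eq))) = ≡.refl

-- S[t]/(tᵉ − 2), with elements given by their coordinates in the basis 1, t, …, t^(e−1).
module AdjoinRootOfTwo {c ℓ} (S : CommutativeRing c ℓ) (m : ℕ) where

  open import Algebra.Structures using (IsCommutativeRing)
  open import Algebra.Definitions
  open import Algebra.Consequences.Setoid using (comm∧idˡ⇒id; comm∧distrˡ⇒distr)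
  import Algebra.Construct.Pointwise as Pointwise
  open import Data.Bool using (true; false; if_then_else_)
  open import Data.Fin as Fin using (Fin; zero; suc; toℕ)
  open import Data.Fin.Properties using (toℕ<n)
  open import Data.Nat as ℕ using (zero; suc; _≡ᵇ_)
  import Data.Nat.Properties as ℕ
  open import Data.Nat.DivMod using (_mod_)
  open import Data.Nat.Tactic.RingSolver using (solve-∀)
  open import Function using (_∘_)
  open import Relation.Binary.Bundles using (Setoid)
  open import Relation.Binary.PropositionalEquality as ≡ using (_≡_; _≢_)
  open import Relation.Binary.Structures using (IsEquivalence)
  open import Relation.Nullary.Decidable using (does; dec-true; dec-false)

  open PowersOfT m public
  private
    module S = CommutativeRing S
  open S using (Carrier)
  open import Algebra.Properties.Semiring.Sum S.semiring
  open import Algebra.Properties.Semiring.Mult S.semiring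
  open import Algebra.Properties.CommutativeMonoid.Mult S.+-commutativeMonoid using (×-distrib-+)
  open CommutativeMonoidSums S.+-commutativeMonoid
  open import Relation.Binary.Reasoning.Setoid S.setoid

  Element : Set c
  Element = Fin e → Carrier

  infix  4 _≈_
  infixl 6 _+_
  infixl 7 _*_
  infix  8 -_
  infix  9 _·t^_

  _≈_ : Element → Element → Set ℓ
  x ≈ y = ∀ k → x k S.≈ y k

  _+_ : Element → Element → Element
  (x + y) k = x k S.+ y k

  -_ : Element → Element
  (- x) k = S.- x k

  0# : Element
  0# _ = S.0#

  _·t^_ : Carrier → Fin e → Element
  (a ·t^ i) k = if does (i Fin.≟ k) then a else S.0#

  1# : Element
  1# = S.1# ·t^ zero

  γ : Fin e → Fin e → Fin e → ℕ
  γ i j k = coeff (toℕ i ℕ.+ toℕ j) k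

  _*_ : Element → Element → Element
  (x * y) k = ∑[ i < e ] (∑[ j < e ] (γ i j k × (x i S.* y j)))

  ·t^-on : ∀ a i → (a ·t^ i) i ≡ a
  ·t^-on a i = ≡.cong (if_then a else S.0#) (dec-true (i Fin.≟ i) ≡.refl)

  ·t^-off : ∀ a {i k} → i ≢ k → (a ·t^ i) k ≡ S.0#
  ·t^-off a {i} {k} i≢k = ≡.cong (if_then a else S.0#) (dec-false (i Fin.≟ k) i≢k)

  ≈-isEquivalence : IsEquivalence _≈_
  ≈-isEquivalence = Pointwise.isEquivalence (Fin e) S.isEquivalence

  ≈-setoid : Setoid c ℓ
  ≈-setoid = record { isEquivalence = ≈-isEquivalence }

  +-cong : Congruent₂ _≈_ _+_
  +-cong x≈x′ y≈y′ k = S.+-cong (x≈x′ k) (y≈y′ k)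

  *-cong : Congruent₂ _≈_ _*_
  *-cong x≈x′ y≈y′ k = sum-cong-≋ λ i → sum-cong-≋ λ j → ×-congʳ (γ i j k) (S.*-cong (x≈x′ i) (y≈y′ j))

  *-comm : Commutative _≈_ _*_
  *-comm x y k = S.trans (∑-comm (λ i j → γ i j k × (x i S.* y j)))
    (sum-cong-≋ λ j → sum-cong-≋ λ i →
      ×-cong (≡.cong (λ s → coeff s k) (ℕ.+-comm (toℕ i) (toℕ j))) (S.*-comm (x i) (y j)))

  *-distribˡ-+ : _DistributesOverˡ_ _≈_ _*_ _+_
  *-distribˡ-+ x y z k = begin
    ∑[ i < e ] (∑[ j < e ] (γ i j k × (x i S.* (y j S.+ z j))))
      ≈⟨ sum-cong-≋ (λ i → sum-cong-≋ λ j → S.trans (×-congʳ (γ i j k) (S.distribˡ (x i) (y j) (z j))) (×-distrib-+ _ _ (γ i j k))) ⟩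
    ∑[ i < e ] (∑[ j < e ] (γ i j k × (x i S.* y j) S.+ γ i j k × (x i S.* z j)))
      ≈⟨ sum-cong-≋ (λ i → ∑-distrib-+ (λ j → γ i j k × (x i S.* y j)) (λ j → γ i j k × (x i S.* z j))) ⟩
    ∑[ i < e ] (∑[ j < e ] (γ i j k × (x i S.* y j)) S.+ ∑[ j < e ] (γ i j k × (x i S.* z j)))
      ≈⟨ ∑-distrib-+ (λ i → ∑[ j < e ] (γ i j k × (x i S.* y j))) (λ i → ∑[ j < e ] (γ i j k × (x i S.* z j))) ⟩
    (x * y) k S.+ (x * z) k
      ∎

  ·t^-*ˡ : ∀ a i x k → ((a ·t^ i) * x) k S.≈ ∑[ j < e ] (γ i j k × (a S.* x j))
  ·t^-*ˡ a i x k = S.trans (sum-δ _ i vanishes) (sum-cong-≋ λ j → ×-congʳ (γ i j k) (S.*-congʳ {x j} (S.reflexive (·t^-on a i))))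
    where
    vanishes : ∀ i′ → i′ ≢ i → ∑[ j < e ] (γ i′ j k × ((a ·t^ i) i′ S.* x j)) S.≈ S.0#
    vanishes i′ i′≢i = begin
      ∑[ j < e ] (γ i′ j k × ((a ·t^ i) i′ S.* x j))
        ≈⟨ sum-cong-≋ (λ j → ×-congʳ (γ i′ j k) (S.trans (S.*-congʳ (S.reflexive (·t^-off a (i′≢i ∘ ≡.sym)))) (S.zeroˡ (x j)))) ⟩
      ∑[ j < e ] (γ i′ j k × S.0#)
        ≈⟨ sum-≈0 (λ j → ×-zeroʳ (γ i′ j k)) ⟩
      S.0#
        ∎

  *-identityˡ : LeftIdentity _≈_ 1# _*_
  *-identityˡ x k = begin
    (1# * x) k                                        ≈⟨ ·t^-*ˡ S.1# zero x k ⟩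
    ∑[ j < e ] (coeff (toℕ j) k × (S.1# S.* x j))     ≈⟨ sum-δ _ k (λ j j≢k → S.reflexive (≡.cong (_× (S.1# S.* x j)) (coeff-offDiagonal j≢k))) ⟩
    coeff (toℕ k) k × (S.1# S.* x k)                  ≈⟨ ×-congˡ (coeff-diagonal k) ⟩
    S.1# S.* x k S.+ S.0#                             ≈⟨ S.trans (S.+-identityʳ _) (S.*-identityˡ (x k)) ⟩
    x k                                               ∎

  private
    *-∑-× : ∀ u (d : Fin e → ℕ) (v : Fin e → Carrier) →
            u S.* ∑[ l < e ] (d l × v l) S.≈ ∑[ l < e ] (d l × (u S.* v l))
    *-∑-× u d v = S.trans (*-distribˡ-sum u (λ l → d l × v l)) (sum-cong-≋ λ l → ×-comm-* (d l) u (v l))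

    ×-∑-× : ∀ n (d : Fin e → ℕ) (w : Fin e → Carrier) →
            n × ∑[ l < e ] (d l × w l) S.≈ ∑[ l < e ] ((n ℕ.* d l) × w l)
    ×-∑-× n d w = S.trans (×-distrib-sum n (λ l → d l × w l)) (sum-cong-≋ λ l → ×-assocˡ (w l) n (d l))

    collapse : ∀ i s k w → ∑[ a < e ] ((coeff (i ℕ.+ toℕ a) k ℕ.* coeff s a) × w) S.≈ coeff (i ℕ.+ s) k × w
    collapse i s k w = S.trans (sum-δ _ (s mod e) vanishes)
      (×-congˡ (≡.trans (≡.cong (coeff (i ℕ.+ toℕ (s mod e)) k ℕ.*_) (coeff-mod s)) (coeff-chain i s k)))
      where
      vanishes : ∀ a → a ≢ s mod e → (coeff (i ℕ.+ toℕ a) k ℕ.* coeff s a) × w S.≈ S.0#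
      vanishes a a≢s = ×-congˡ (≡.trans (≡.cong (coeff (i ℕ.+ toℕ a) k ℕ.*_) (coeff-off-mod s a a≢s)) (ℕ.*-zeroʳ (coeff (i ℕ.+ toℕ a) k)))

  triple : Element → Element → Element → Element
  triple x y z k = ∑[ i < e ] (∑[ j < e ] (∑[ l < e ] (coeff (toℕ i ℕ.+ (toℕ j ℕ.+ toℕ l)) k × (x i S.* (y j S.* z l)))))

  *-expandʳ : ∀ x y z → x * (y * z) ≈ triple x y z
  *-expandʳ x y z k = begin
    ∑[ i < e ] (∑[ a < e ] (γ i a k × (x i S.* (y * z) a)))
      ≈⟨ sum-cong-≋ (λ i → sum-cong-≋ λ a → distribute i a) ⟩
    ∑[ i < e ] (∑[ a < e ] (∑[ j < e ] (∑[ l < e ] ((γ i a k ℕ.* γ j l a) × w i j l))))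
      ≈⟨ sum-cong-≋ (λ i → ∑-rotate₃ (λ a j l → (γ i a k ℕ.* γ j l a) × w i j l)) ⟩
    ∑[ i < e ] (∑[ j < e ] (∑[ l < e ] (∑[ a < e ] ((γ i a k ℕ.* γ j l a) × w i j l))))
      ≈⟨ sum-cong-≋ (λ i → sum-cong-≋ λ j → sum-cong-≋ λ l → collapse (toℕ i) (toℕ j ℕ.+ toℕ l) k (w i j l)) ⟩
    triple x y z k
      ∎
    where
    w : Fin e → Fin e → Fin e → Carrier
    w i j l = x i S.* (y j S.* z l)
    distribute : ∀ i a → γ i a k × (x i S.* (y * z) a) S.≈ ∑[ j < e ] (∑[ l < e ] ((γ i a k ℕ.* γ j l a) × w i j l))
    distribute i a = begin
      γ i a k × (x i S.* ∑[ j < e ] (∑[ l < e ] (γ j l a × (y j S.* z l))))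
        ≈⟨ ×-congʳ (γ i a k) (*-distribˡ-sum (x i) (λ j → ∑[ l < e ] (γ j l a × (y j S.* z l)))) ⟩
      γ i a k × ∑[ j < e ] (x i S.* ∑[ l < e ] (γ j l a × (y j S.* z l)))
        ≈⟨ ×-congʳ (γ i a k) (sum-cong-≋ λ j → *-∑-× (x i) (λ l → γ j l a) (λ l → y j S.* z l)) ⟩
      γ i a k × ∑[ j < e ] (∑[ l < e ] (γ j l a × w i j l))
        ≈⟨ ×-distrib-sum (γ i a k) (λ j → ∑[ l < e ] (γ j l a × w i j l)) ⟩
      ∑[ j < e ] (γ i a k × ∑[ l < e ] (γ j l a × w i j l))
        ≈⟨ sum-cong-≋ (λ j → ×-∑-× (γ i a k) (λ l → γ j l a) (w i j)) ⟩
      ∑[ j < e ] (∑[ l < e ] ((γ i a k ℕ.* γ j l a) × w i j l))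
        ∎

  triple-reverse : ∀ x y z → triple z y x ≈ triple x y z
  triple-reverse x y z k = S.trans
    (∑-reverse₃ (λ i j l → coeff (toℕ i ℕ.+ (toℕ j ℕ.+ toℕ l)) k × (z i S.* (y j S.* x l))))
    (sum-cong-≋ λ l → sum-cong-≋ λ j → sum-cong-≋ λ i →
      ×-cong (≡.cong (λ s → coeff s k) (exponents (toℕ i) (toℕ j) (toℕ l))) (products (z i) (y j) (x l)))
    where
    exponents : ∀ i j l → i ℕ.+ (j ℕ.+ l) ≡ l ℕ.+ (j ℕ.+ i)
    exponents = solve-∀
    products : ∀ a b c → a S.* (b S.* c) S.≈ c S.* (b S.* a)
    products a b c = S.trans (S.*-comm a (b S.* c)) (S.trans (S.*-congʳ (S.*-comm b c)) (S.*-assoc c b a))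

  *-assoc : Associative _≈_ _*_
  *-assoc x y z k = begin
    ((x * y) * z) k    ≈⟨ *-comm (x * y) z k ⟩
    (z * (x * y)) k    ≈⟨ *-cong {z} (λ _ → S.refl) (*-comm x y) k ⟩
    (z * (y * x)) k    ≈⟨ *-expandʳ z y x k ⟩
    triple z y x k     ≈⟨ triple-reverse x y z k ⟩
    triple x y z k     ≈⟨ *-expandʳ x y z k ⟨
    (x * (y * z)) k    ∎

  isCommutativeRing : IsCommutativeRing _≈_ _+_ _*_ -_ 0# 1#
  isCommutativeRing = record
    { isRing = record
      { +-isAbelianGroup = Pointwise.isAbelianGroup (Fin e) S.+-isAbelianGroup
      ; *-cong           = *-cong
      ; *-assoc          = *-assoc
      ; *-identity       = comm∧idˡ⇒id ≈-setoid *-comm {1#} *-identityˡ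
      ; distrib          = comm∧distrˡ⇒distr ≈-setoid +-cong *-comm *-distribˡ-+
      }
    ; *-comm = *-comm
    }

  commutativeRing : CommutativeRing c ℓ
  commutativeRing = record { isCommutativeRing = isCommutativeRing }

  ·t^-*-·t^ : ∀ a b i j → (a ·t^ i) * (b ·t^ j) ≈ λ k → γ i j k × (a S.* b)
  ·t^-*-·t^ a b i j k = S.trans (·t^-*ˡ a i (b ·t^ j) k)
    (S.trans (sum-δ _ j vanishes) (×-congʳ (γ i j k) (S.*-congˡ (S.reflexive (·t^-on b j)))))
    where
    vanishes : ∀ j′ → j′ ≢ j → γ i j′ k × (a S.* (b ·t^ j) j′) S.≈ S.0#
    vanishes j′ j′≢j = S.trans (×-congʳ (γ i j′ k) (S.trans (S.*-congˡ (S.reflexive (·t^-off b (j′≢j ∘ ≡.sym)))) (S.zeroʳ a)))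
                               (×-zeroʳ (γ i j′ k))

  ·t^-squared : ∀ f → toℕ f ℕ.+ toℕ f ≡ e → (S.1# ·t^ f) * (S.1# ·t^ f) ≈ 1# + 1#
  ·t^-squared f f+f≡e k = begin
    ((S.1# ·t^ f) * (S.1# ·t^ f)) k      ≈⟨ ·t^-*-·t^ S.1# S.1# f f k ⟩
    γ f f k × (S.1# S.* S.1#)            ≡⟨ ≡.cong (λ s → coeff s k × (S.1# S.* S.1#)) (≡.trans f+f≡e (≡.sym (ℕ.+-identityʳ e))) ⟩
    coeff (e ℕ.+ 0) k × (S.1# S.* S.1#)  ≡⟨ ≡.cong (_× (S.1# S.* S.1#)) (coeff-shift 0 1 k) ⟩
    (2 ℕ.* coeff 0 k) × (S.1# S.* S.1#)  ≈⟨ doubled k ⟩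
    (1# + 1#) k                          ∎
    where
    doubled : ∀ k → (2 ℕ.* coeff 0 k) × (S.1# S.* S.1#) S.≈ (1# + 1#) k
    doubled zero    = S.+-cong (S.*-identityˡ S.1#) (S.trans (S.+-identityʳ _) (S.*-identityˡ S.1#))
    doubled (suc k) = S.sym (S.+-identityʳ S.0#)

  const : Carrier → Element
  const a = a ·t^ zero

  const-cong : ∀ {a b} → a S.≈ b → const a ≈ const b
  const-cong a≈b zero    = a≈b
  const-cong a≈b (suc _) = S.refl

  const-0 : const S.0# ≈ 0#
  const-0 zero    = S.refl
  const-0 (suc _) = S.refl

  const-+ : ∀ a b → const (a S.+ b) ≈ const a + const b
  const-+ a b zero    = S.refl
  const-+ a b (suc _) = S.sym (S.+-identityʳ S.0#)

  const-* : ∀ a b → const (a S.* b) ≈ const a * const b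
  const-* a b k = S.sym (S.trans (·t^-*-·t^ a b zero zero k) (constant k))
    where
    constant : ∀ k → coeff 0 k × (a S.* b) S.≈ const (a S.* b) k
    constant zero    = S.+-identityʳ (a S.* b)
    constant (suc _) = S.refl

  -- The multiplication table in the form in which Defs writes out _*R_.
  γ-byCases : ∀ i j k u →
    (if toℕ i ℕ.+ toℕ j ≡ᵇ toℕ k then u else if toℕ i ℕ.+ toℕ j ≡ᵇ toℕ k ℕ.+ e then u S.+ u else S.0#) S.≈ γ i j k × u
  γ-byCases i j k u = S.trans (byCases (toℕ i ℕ.+ toℕ j ≡ᵇ toℕ k) (toℕ i ℕ.+ toℕ j ≡ᵇ toℕ k ℕ.+ e))
    (S.reflexive (≡.cong (_× u) (≡.sym (coeff-<2e (toℕ i ℕ.+ toℕ j) k (ℕ.+-mono-< (toℕ<n i) (toℕ<n j))))))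
    where
    byCases : ∀ b₁ b₂ → (if b₁ then u else if b₂ then u S.+ u else S.0#) S.≈ (if b₁ then 1 else if b₂ then 2 else 0) × u
    byCases true  _     = S.sym (S.+-identityʳ u)
    byCases false true  = S.+-congˡ (S.sym (S.+-identityʳ u))
    byCases false false = S.refl

open import Data.Bool using (if_then_else_)
open import Data.Fin using (Fin; zero; suc; toℕ; fromℕ<)
open import Data.Fin.Properties using (toℕ-fromℕ<)
open import Data.List using (List; []; _∷_; _++_; length)
open import Data.Nat as ℕ using (zero; suc; _≤_; _≡ᵇ_; s≤s)
import Data.Nat.Properties as ℕ
open import Data.Nat.Divisibility using (_∣_; divides)
open import Data.Product using (Σ; Σ-syntax; _×_; _,_; proj₁; proj₂)
open import Relation.Binary.PropositionalEquality as ≡ using (_≡_)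
open import Data.Nat.Tactic.RingSolver using (solve-∀)
open TwoAdic using (ℤ₂-commutativeRing)
open Hensel using (√-5/19)

-- For e = suc m, Defs' R e, _+R_, 0R and _≈R_ are definitionally Element, _+_, 0# and
-- _≈_ of AdjoinRootOfTwo ℤ₂-commutativeRing m; _*R_ agrees with _*_ up to _≈_.
module Coordinates (m : ℕ) where

  open AdjoinRootOfTwo ℤ₂-commutativeRing m public
  open import Algebra.Properties.Semiring.Sum ℤ₂.semiring using (sum; sum-cong-≋)
  module V = CommutativeRing commutativeRing
  open SumsOfSquares commutativeRing public

  sumFin≡sum : ∀ {n} (f : Fin n → ℤ₂) → sumFin f ≡ sum f
  sumFin≡sum {zero}  f = ≡.refl
  sumFin≡sum {suc n} f = ≡.cong (f zero +ℤ₂_) (sumFin≡sum (λ i → f (suc i)))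

  *R≈* : ∀ (x y : R e) → (x *R y) ≈ x * y
  *R≈* x y k = begin
    sumFin (λ i → sumFin (λ j → term i j))  ≡⟨ sumFin≡sum (λ i → sumFin (λ j → term i j)) ⟩
    sum (λ i → sumFin (λ j → term i j))     ≈⟨ sum-cong-≋ (λ i → ℤ₂.trans (ℤ₂.reflexive (sumFin≡sum (λ j → term i j)))
                                                                          (sum-cong-≋ λ j → γ-byCases i j k (x i *ℤ₂ y j))) ⟩
    (x * y) k                               ∎
    where
    open import Relation.Binary.Reasoning.Setoid ℤ₂.setoid
    term : Fin e → Fin e → ℤ₂
    term i j = if (toℕ i ℕ.+ toℕ j) ≡ᵇ toℕ k then x i *ℤ₂ y j
               else if (toℕ i ℕ.+ toℕ j) ≡ᵇ (toℕ k ℕ.+ e) then (x i *ℤ₂ y j) +ℤ₂ (x i *ℤ₂ y j)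
               else 0ℤ₂

  sumSq≈sumOfSquares : ∀ xs → sumSq e xs ≈ sumOfSquares xs
  sumSq≈sumOfSquares []       = V.refl
  sumSq≈sumOfSquares (x ∷ xs) = V.+-cong (*R≈* x x) (sumSq≈sumOfSquares xs)

  InR²⇒sumOfSquares : ∀ {y} → InR² e y → Σ[ xs ∈ List (R e) ] y ≈ sumOfSquares xs
  InR²⇒sumOfSquares (square x y≈x²) = x ∷ [] , V.trans y≈x² (V.trans (*R≈* x x) (V.sym (V.+-identityʳ (x * x))))
  InR²⇒sumOfSquares (plus a b a∈R² b∈R² y≈a+b) =
    let xs , a≈xs = InR²⇒sumOfSquares a∈R²
        ys , b≈ys = InR²⇒sumOfSquares b∈R²
    in xs ++ ys , V.trans y≈a+b (V.trans (V.+-cong a≈xs b≈ys) (V.sym (sumOfSquares-++ xs ys)))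

  const-fromℕ : ∀ n → const (ℤ₂.fromℕ n) ≈ fromℕ n
  const-fromℕ 0             = const-0
  const-fromℕ 1             = V.refl
  const-fromℕ (suc (suc n)) = V.trans (const-+ (ℤ₂.fromℕ (suc n)) ℤ₂.1#) (V.+-congʳ (const-fromℕ (suc n)))

  const-root : ∀ {c} → ℤ₂.fromℕ 19 ℤ₂.* (c ℤ₂.* c) ℤ₂.+ ℤ₂.fromℕ 5 ℤ₂.≈ ℤ₂.0# →
               fromℕ 19 * (const c * const c) + fromℕ 5 ≈ 0#
  const-root {c} root = begin
    fromℕ 19 * (const c * const c) + fromℕ 5                      ≈⟨ V.+-cong (V.*-cong (V.sym (const-fromℕ 19)) (V.sym (const-* c c)))
                                                                                (V.sym (const-fromℕ 5)) ⟩
    const (ℤ₂.fromℕ 19) * const (c ℤ₂.* c) + const (ℤ₂.fromℕ 5)  ≈⟨ V.+-congʳ (V.sym (const-* (ℤ₂.fromℕ 19) (c ℤ₂.* c))) ⟩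
    const (ℤ₂.fromℕ 19 ℤ₂.* (c ℤ₂.* c)) + const (ℤ₂.fromℕ 5)     ≈⟨ const-+ (ℤ₂.fromℕ 19 ℤ₂.* (c ℤ₂.* c)) (ℤ₂.fromℕ 5) ⟨
    const (ℤ₂.fromℕ 19 ℤ₂.* (c ℤ₂.* c) ℤ₂.+ ℤ₂.fromℕ 5)          ≈⟨ const-cong root ⟩
    const ℤ₂.0#                                                   ≈⟨ const-0 ⟩
    0#                                                            ∎
    where open import Relation.Binary.Reasoning.Setoid V.setoid

  const-√-5/19 : fromℕ 19 * (const (proj₁ √-5/19) * const (proj₁ √-5/19)) + fromℕ 5 ≈ 0#
  const-√-5/19 = const-root (proj₂ √-5/19)

  module _ (half : Fin e) (half+half≡e : toℕ half ℕ.+ toℕ half ≡ e) where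

    -- ρ and c are passed explicitly below: inferring them unfolds ℤ₂ arithmetic bit by bit.
    InR²⇒sumOfThreeSquares : ∀ {y} → InR² e y → Σ[ ys ∈ List (R e) ] length ys ≤ 3 × y ≈R sumSq e ys
    InR²⇒sumOfThreeSquares y∈R² =
      let xs , y≈xs          = InR²⇒sumOfSquares y∈R²
          ys , |ys|≡3 , xs≈ys = sumOfSquares≈sumOfThreeSquares {ℤ₂.1# ·t^ half} {const (proj₁ √-5/19)}
                                  (·t^-squared half half+half≡e) const-√-5/19 xs
      in ys , ℕ.≤-reflexive |ys|≡3 , V.trans y≈xs (V.trans xs≈ys (V.sym (sumSq≈sumOfSquares ys)))

lemma3p13 : (e : ℕ) → 2 ≤ e → 2 ∣ e → (y : R e) → InR² e y →
    Σ (List (R e)) (λ xs → length xs ≤ 3 × y ≈R sumSq e xs)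
lemma3p13 _ () (divides zero ≡.refl)
lemma3p13 _ _ (divides (suc f) ≡.refl) y = InR²⇒sumOfThreeSquares half half+half≡e
  where
  open Coordinates (suc (f ℕ.* 2))
  f+1<e : suc f ℕ.< e
  f+1<e = s≤s (s≤s (ℕ.m≤m*n f 2))
  half : Fin e
  half = fromℕ< f+1<e
  half+half≡e : toℕ half ℕ.+ toℕ half ≡ e
  half+half≡e = ≡.trans (≡.cong₂ ℕ._+_ (toℕ-fromℕ< f+1<e) (toℕ-fromℕ< f+1<e)) (double f)
    where
    double : ∀ f → suc f ℕ.+ suc f ≡ suc (suc (f ℕ.* 2))
    double = solve-∀
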